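{- Every dark ceer is hereditarily self-full.
   Context: A ceer is a computably enumerable equivalence relation on $\omega$. A ceer is dark if it has infinitely many classes and admits no infinite c.e. set of pairwise non-equivalent elements. A computable reduction of $R$ to $S$ is a total computable $f$ with $x\,R\,y \Leftrightarrow f(x)\,S\,f(y)$. A ceer $R$ is self-full if every computable reduction of $R$ to $R$ has range intersecting every $R$-class. The uniform join is $R\oplus S=\{(2x,2y):(x,y)\in R\}\cup\{(2x+1,2y+1):(x,y)\in S\}$. A ceer $X$ is hereditarily self-full if $X\oplus Y$ is self-full for every self-full ceer $Y$. -}

module Defs where

open import Data.Nat using (ℕ; zero; suc; _*_; _<_)
open import Data.Fin using (Fin)
open import Data.Vec using (Vec; []; _∷_; lookup)
open import Data.List using (List)
open import Data.List.Relation.Unary.Any using (Any)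
open import Data.List.Membership.Propositional using (_∈_)
open import Data.Product using (Σ; ∃; _×_; _,_)
open import Relation.Nullary using (¬_)
open import Relation.Binary.PropositionalEquality using (_≡_; _≢_)
open import Relation.Binary.Structures using (IsEquivalence)
open import Level using (0ℓ)

data PR : ℕ → Set where
  zer  : ∀ {n} → PR n
  succ : PR 1
  proj : ∀ {n} → Fin n → PR n
  comp : ∀ {m n} → PR m → Vec (PR n) m → PR n
  prec : ∀ {n} → PR n → PR (suc (suc n)) → PR (suc n)
  mu   : ∀ {n} → PR (suc n) → PR n

-- Big-step semantics:  c ⟨ xs ⟩⇓ v  means the partial function coded by c
-- halts on input xs with output v.
infix 4 _⟨_⟩⇓_ _⟨_⟩⇓*_
data _⟨_⟩⇓_ : ∀ {n} → PR n → Vec ℕ n → ℕ → Set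
data _⟨_⟩⇓*_ : ∀ {n m} → Vec (PR n) m → Vec ℕ n → Vec ℕ m → Set

data _⟨_⟩⇓_ where
  ev-zer  : ∀ {n} {xs : Vec ℕ n} → zer ⟨ xs ⟩⇓ 0
  ev-succ : ∀ {x} → succ ⟨ x ∷ [] ⟩⇓ suc x
  ev-proj : ∀ {n} {i : Fin n} {xs} → proj i ⟨ xs ⟩⇓ lookup xs i
  ev-comp : ∀ {m n} {f : PR m} {gs : Vec (PR n) m} {xs ys v} →
            gs ⟨ xs ⟩⇓* ys → f ⟨ ys ⟩⇓ v → comp f gs ⟨ xs ⟩⇓ v
  ev-prec-zero : ∀ {n} {f : PR n} {g} {xs v} →
            f ⟨ xs ⟩⇓ v → prec f g ⟨ 0 ∷ xs ⟩⇓ v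
  ev-prec-suc : ∀ {n} {f : PR n} {g} {k xs r v} →
            prec f g ⟨ k ∷ xs ⟩⇓ r → g ⟨ k ∷ r ∷ xs ⟩⇓ v →
            prec f g ⟨ suc k ∷ xs ⟩⇓ v
  ev-mu   : ∀ {n} {f : PR (suc n)} {xs k} →
            f ⟨ k ∷ xs ⟩⇓ 0 →
            (∀ j → j < k → Σ ℕ λ w → f ⟨ j ∷ xs ⟩⇓ suc w) →
            mu f ⟨ xs ⟩⇓ k

data _⟨_⟩⇓*_ where
  ev-[] : ∀ {n} {xs : Vec ℕ n} → [] ⟨ xs ⟩⇓* []
  ev-∷  : ∀ {n m} {g : PR n} {gs : Vec (PR n) m} {xs y ys} →
          g ⟨ xs ⟩⇓ y → gs ⟨ xs ⟩⇓* ys → (g ∷ gs) ⟨ xs ⟩⇓* (y ∷ ys)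

_⟨_⟩↓ : ∀ {n} → PR n → Vec ℕ n → Set
c ⟨ xs ⟩↓ = Σ ℕ λ v → c ⟨ xs ⟩⇓ v

Computable : (ℕ → ℕ) → Set
Computable f = Σ (PR 1) λ c → ∀ x → c ⟨ x ∷ [] ⟩⇓ f x

IsCESet : (ℕ → Set) → Set
IsCESet A = Σ (PR 1) λ c → ∀ x → (A x → c ⟨ x ∷ [] ⟩↓) × (c ⟨ x ∷ [] ⟩↓ → A x)

IsCERel : (ℕ → ℕ → Set) → Set
IsCERel R = Σ (PR 2) λ c → ∀ x y →
  (R x y → c ⟨ x ∷ y ∷ [] ⟩↓) × (c ⟨ x ∷ y ∷ [] ⟩↓ → R x y)

record Ceer : Set₁ where
  field
    rel   : ℕ → ℕ → Set
    isEq  : IsEquivalence rel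
    isCE  : IsCERel rel

Finite : (ℕ → Set) → Set
Finite A = Σ (List ℕ) λ xs → ∀ y → A y → y ∈ xs

Infinite : (ℕ → Set) → Set
Infinite A = ¬ Finite A

InfinitelyManyClasses : (ℕ → ℕ → Set) → Set
InfinitelyManyClasses R = ¬ (Σ (List ℕ) λ xs → ∀ y → Any (R y) xs)

PairwiseInequivalent : (ℕ → ℕ → Set) → (ℕ → Set) → Set
PairwiseInequivalent R A = ∀ x y → A x → A y → x ≢ y → ¬ R x y

Dark : Ceer → Set₁
Dark X = InfinitelyManyClasses R ×
         ¬ (Σ (ℕ → Set) λ A → IsCESet A × Infinite A × PairwiseInequivalent R A)
  where R = Ceer.rel X

IsReduction : (ℕ → ℕ → Set) → (ℕ → ℕ → Set) → (ℕ → ℕ) → Set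
IsReduction R S f = Computable f ×
  (∀ x y → (R x y → S (f x) (f y)) × (S (f x) (f y) → R x y))

SelfFull : (ℕ → ℕ → Set) → Set
SelfFull R = ∀ f → IsReduction R R f → ∀ x → Σ ℕ λ y → R (f y) x

data Join (R S : ℕ → ℕ → Set) : ℕ → ℕ → Set where
  inl : ∀ {x y} → R x y → Join R S (2 * x) (2 * y)
  inr : ∀ {x y} → S x y → Join R S (suc (2 * x)) (suc (2 * y))

HereditarilySelfFull : Ceer → Set₁
HereditarilySelfFull X =
  (Y : Ceer) → SelfFull (Ceer.rel Y) → SelfFull (Join (Ceer.rel X) (Ceer.rel Y))

-- Let f be a computable self-reduction of X ⊕ Y, X dark and Y self-full. If the f-orbit of a point
-- never returns to its class and stays among the even numbers, the halves of its points form an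
-- infinite c.e. set of pairwise X-inequivalent numbers, which darkness forbids; so (classically)
-- the orbit of every odd point, and of every point whose class f misses, reaches an odd number.
-- Halving the first odd point of the orbit of 2y+1 is then a computable self-reduction g of Y,
-- whose range meets every Y-class because Y is self-full; this hits all odd classes of X ⊕ Y.
-- For an even class missed by f, its first odd orbit point is reached by the orbit of an odd point,
-- and comparing the two orbit lengths shows that the class is in the range of f after all.

module Submission where

open import Defs
open import Axiom.ExcludedMiddle using (ExcludedMiddle)
open import Level using (0ℓ)

open import Data.Nat
open import Data.Nat.Properties
open import Data.Nat.GeneralisedArithmetic using (fold; fold-+)
open import Data.Fin using (Fin; zero; suc; toℕ)
open import Data.Fin.Properties using (pigeonhole)
open import Data.Vec using (Vec; []; _∷_; head; tail)
open import Data.List using (length)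
import Data.List as List
open import Data.List.Relation.Unary.Any using (index)
open import Data.List.Relation.Unary.Any.Properties using (lookup-index)
open import Data.Product using (Σ; ∃; _×_; _,_; proj₁; proj₂)
open import Data.Sum using (_⊎_; inj₁; inj₂)
open import Data.Empty using (⊥; ⊥-elim)
open import Function.Bundles using (_⇔_; mk⇔; Equivalence)
open import Relation.Binary.Definitions using (Symmetric; tri<; tri≈; tri>)
open import Relation.Binary.Structures using (IsEquivalence)
open import Relation.Binary.PropositionalEquality hiding (J)
open import Relation.Nullary using (¬_; yes; no)
open import Relation.Unary using (Pred; Decidable)

⇓-deterministic : ∀ {n} {c : PR n} {xs u v} → c ⟨ xs ⟩⇓ u → c ⟨ xs ⟩⇓ v → u ≡ v
⇓*-deterministic : ∀ {n m} {cs : Vec (PR n) m} {xs us vs} →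
                   cs ⟨ xs ⟩⇓* us → cs ⟨ xs ⟩⇓* vs → us ≡ vs
⇓-deterministic ev-zer ev-zer = refl
⇓-deterministic ev-succ ev-succ = refl
⇓-deterministic ev-proj ev-proj = refl
⇓-deterministic (ev-comp gs f) (ev-comp gs′ f′)
  rewrite ⇓*-deterministic gs gs′ = ⇓-deterministic f f′
⇓-deterministic (ev-prec-zero f) (ev-prec-zero f′) = ⇓-deterministic f f′
⇓-deterministic (ev-prec-suc r g) (ev-prec-suc r′ g′)
  rewrite ⇓-deterministic r r′ = ⇓-deterministic g g′
⇓-deterministic (ev-mu {k = k} root below) (ev-mu {k = k′} root′ below′) with <-cmp k k′
... | tri< k<k′ _ _ = ⊥-elim (0≢1+n (⇓-deterministic root (proj₂ (below′ k k<k′))))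
... | tri≈ _ k≡k′ _ = k≡k′
... | tri> _ _ k′<k = ⊥-elim (0≢1+n (⇓-deterministic root′ (proj₂ (below k′ k′<k))))
⇓*-deterministic ev-[] ev-[] = refl
⇓*-deterministic (ev-∷ g gs) (ev-∷ g′ gs′) =
  cong₂ _∷_ (⇓-deterministic g g′) (⇓*-deterministic gs gs′)

record TotalCode (n : ℕ) (F : Vec ℕ n → ℕ) : Set where
  field
    code     : PR n
    computes : ∀ xs → code ⟨ xs ⟩⇓ F xs
open TotalCode

TotalCode₁ : (ℕ → ℕ) → Set
TotalCode₁ h = TotalCode 1 (λ xs → h (head xs))

TotalCode₂ : (ℕ → ℕ → ℕ) → Set
TotalCode₂ h = TotalCode 2 (λ xs → h (head xs) (head (tail xs)))

TotalCode-cong : ∀ {n F G} → (∀ xs → F xs ≡ G xs) → TotalCode n F → TotalCode n G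
TotalCode-cong F≗G t = record
  { code = code t ; computes = λ xs → subst (code t ⟨ xs ⟩⇓_) (F≗G xs) (computes t xs) }

computable⇒totalCode : ∀ {h} → Computable h → TotalCode₁ h
computable⇒totalCode (c , c⇓) = record { code = c ; computes = λ { (x ∷ []) → c⇓ x } }

totalCode⇒computable : ∀ {h} → TotalCode₁ h → Computable h
totalCode⇒computable t = code t , λ x → computes t (x ∷ [])

zeroᵗ : ∀ {n} → TotalCode n (λ _ → 0)
zeroᵗ = record { code = zer ; computes = λ _ → ev-zer }

sucᵗ : TotalCode₁ suc
sucᵗ = record { code = succ ; computes = λ { (x ∷ []) → ev-succ } }

firstᵗ : ∀ {n} → TotalCode (suc n) head
firstᵗ = record { code = proj zero ; computes = λ { (x ∷ _) → ev-proj } }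

secondᵗ : ∀ {n} → TotalCode (suc (suc n)) (λ xs → head (tail xs))
secondᵗ = record { code = proj (suc zero) ; computes = λ { (_ ∷ y ∷ _) → ev-proj } }

comp₁ : ∀ {n F G} → TotalCode 1 F → TotalCode n G → TotalCode n (λ xs → F (G xs ∷ []))
comp₁ t u = record
  { code     = comp (code t) (code u ∷ [])
  ; computes = λ xs → ev-comp (ev-∷ (computes u xs) ev-[]) (computes t _) }

comp₂ : ∀ {n F G H} → TotalCode 2 F → TotalCode n G → TotalCode n H →
        TotalCode n (λ xs → F (G xs ∷ H xs ∷ []))
comp₂ t u v = record
  { code     = comp (code t) (code u ∷ code v ∷ [])
  ; computes = λ xs → ev-comp (ev-∷ (computes u xs) (ev-∷ (computes v xs) ev-[]))
                              (computes t _) }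

constᵗ : ∀ {n} a → TotalCode n (λ _ → a)
constᵗ zero    = zeroᵗ
constᵗ (suc a) = comp₁ sucᵗ (constᵗ a)

primRec : ∀ {n} → (Vec ℕ n → ℕ) → (Vec ℕ (suc (suc n)) → ℕ) → ℕ → Vec ℕ n → ℕ
primRec G H zero    xs = G xs
primRec G H (suc k) xs = H (k ∷ primRec G H k xs ∷ xs)

primRecᵗ : ∀ {n G H} → TotalCode n G → TotalCode (suc (suc n)) H →
           TotalCode (suc n) (λ xs → primRec G H (head xs) (tail xs))
primRecᵗ {G = G} {H} t u = record { code = prec (code t) (code u) ; computes = go }
  where
  go : ∀ xs → prec (code t) (code u) ⟨ xs ⟩⇓ primRec G H (head xs) (tail xs)
  go (zero  ∷ xs) = ev-prec-zero (computes t xs)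
  go (suc k ∷ xs) = ev-prec-suc (go (k ∷ xs)) (computes u _)

iterateᵗ : ∀ {S} → TotalCode 1 S → TotalCode₂ (λ k z → fold z (λ x → S (x ∷ [])) k)
iterateᵗ {S} t = TotalCode-cong (λ { (k ∷ z ∷ []) → primRec≡fold k z })
                               (primRecᵗ firstᵗ (comp₁ t secondᵗ))
  where
  s : ℕ → ℕ
  s x = S (x ∷ [])

  primRec≡fold : ∀ k z → primRec head (λ xs → s (head (tail xs))) k (z ∷ []) ≡ fold z s k
  primRec≡fold zero    z = refl
  primRec≡fold (suc k) z = cong s (primRec≡fold k z)

addᵗ : TotalCode₂ _+_
addᵗ = TotalCode-cong (λ { (k ∷ y ∷ []) → fold-suc≡+ k y }) (iterateᵗ sucᵗ)
  where
  fold-suc≡+ : ∀ k y → fold y suc k ≡ k + y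
  fold-suc≡+ zero    y = refl
  fold-suc≡+ (suc k) y = cong suc (fold-suc≡+ k y)

doubleᵗ : TotalCode₁ (2 *_)
doubleᵗ = comp₂ addᵗ firstᵗ (comp₂ addᵗ firstᵗ zeroᵗ)

predᵗ : TotalCode₁ pred
predᵗ = TotalCode-cong (λ { (zero ∷ []) → refl ; (suc k ∷ []) → refl })
                       (primRecᵗ zeroᵗ firstᵗ)

monusᵗ : TotalCode₂ _∸_
monusᵗ = TotalCode-cong (λ { (m ∷ k ∷ []) → fold-pred≡∸ m k })
                        (comp₂ (iterateᵗ predᵗ) secondᵗ firstᵗ)
  where
  fold-pred≡∸ : ∀ m k → fold m pred k ≡ m ∸ k
  fold-pred≡∸ m zero    = refl
  fold-pred≡∸ m (suc k) = trans (cong pred (fold-pred≡∸ m k)) (pred[m∸n]≡m∸[1+n] m k)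

∸+∸≡∣-∣ : ∀ m n → (m ∸ n) + (n ∸ m) ≡ ∣ m - n ∣
∸+∸≡∣-∣ zero    zero    = refl
∸+∸≡∣-∣ zero    (suc n) = refl
∸+∸≡∣-∣ (suc m) zero    = +-identityʳ (suc m)
∸+∸≡∣-∣ (suc m) (suc n) = ∸+∸≡∣-∣ m n

distᵗ : TotalCode₂ ∣_-_∣
distᵗ = TotalCode-cong (λ { (m ∷ n ∷ []) → ∸+∸≡∣-∣ m n })
                       (comp₂ addᵗ monusᵗ (comp₂ monusᵗ secondᵗ firstᵗ))

isZero : ℕ → ℕ
isZero zero    = 1
isZero (suc _) = 0

-- 1 on even numbers and 0 on odd ones, so that "odd" is the root predicate of a computable function.
evenness : ℕ → ℕ
evenness zero    = 1
evenness (suc n) = isZero (evenness n)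

Even Odd : ℕ → Set
Even n = evenness n ≡ 1
Odd  n = evenness n ≡ 0

half : ℕ → ℕ
half zero    = 0
half (suc n) = half n + isZero (evenness n)

isZeroᵗ : TotalCode₁ isZero
isZeroᵗ = TotalCode-cong (λ { (zero ∷ []) → refl ; (suc k ∷ []) → refl })
                         (primRecᵗ (constᵗ 1) zeroᵗ)

evennessᵗ : TotalCode₁ evenness
evennessᵗ = TotalCode-cong (λ { (n ∷ []) → fold-isZero≡evenness n })
                           (comp₂ (iterateᵗ isZeroᵗ) firstᵗ (constᵗ 1))
  where
  fold-isZero≡evenness : ∀ n → fold 1 isZero n ≡ evenness n
  fold-isZero≡evenness zero    = refl
  fold-isZero≡evenness (suc n) = cong isZero (fold-isZero≡evenness n)

halfᵗ : TotalCode₁ half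
halfᵗ = TotalCode-cong (λ { (n ∷ []) → primRec≡half n })
  (primRecᵗ zeroᵗ (comp₂ addᵗ secondᵗ (comp₁ isZeroᵗ (comp₁ evennessᵗ firstᵗ))))
  where
  primRec≡half : ∀ n →
    primRec (λ _ → 0) (λ xs → head (tail xs) + isZero (evenness (head xs))) n [] ≡ half n
  primRec≡half zero    = refl
  primRec≡half (suc n) = cong (_+ isZero (evenness n)) (primRec≡half n)

evenness-double : ∀ k → Even (2 * k)
evenness-double zero    = refl
evenness-double (suc k) =
  trans (cong evenness (*-suc 2 k)) (cong (λ e → isZero (isZero e)) (evenness-double k))

evenness-odd : ∀ k → Odd (suc (2 * k))
evenness-odd k rewrite evenness-double k = refl

parity-view : ∀ n → (Even n × n ≡ 2 * half n) ⊎ (Odd n × n ≡ suc (2 * half n))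
parity-view zero = inj₁ (refl , refl)
parity-view (suc n) with parity-view n
... | inj₁ (n-even , n≡2h) rewrite n-even =
  inj₂ (refl , cong suc (trans n≡2h (cong (2 *_) (sym (+-identityʳ (half n))))))
... | inj₂ (n-odd , n≡2h+1) rewrite n-odd = inj₁ (refl , (begin
  suc n                  ≡⟨ cong suc n≡2h+1 ⟩
  suc (suc (2 * half n)) ≡⟨ sym (*-suc 2 (half n)) ⟩
  2 * suc (half n)       ≡⟨ cong (2 *_) (+-comm 1 (half n)) ⟩
  2 * (half n + 1)       ∎))
  where open ≡-Reasoning

¬Odd⇒Even : ∀ n → ¬ Odd n → Even n
¬Odd⇒Even n ¬odd with parity-view n
... | inj₁ (n-even , _) = n-even
... | inj₂ (n-odd , _)  = ⊥-elim (¬odd n-odd)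

Odd⇒≡suc-double : ∀ {n} → Odd n → n ≡ suc (2 * half n)
Odd⇒≡suc-double {n} n-odd with parity-view n
... | inj₁ (n-even , _) = ⊥-elim (0≢1+n (trans (sym n-odd) n-even))
... | inj₂ (_ , n≡2h+1) = n≡2h+1

Even⇒≡double : ∀ {n} → Even n → n ≡ 2 * half n
Even⇒≡double {n} n-even with parity-view n
... | inj₁ (_ , n≡2h)  = n≡2h
... | inj₂ (n-odd , _) = ⊥-elim (0≢1+n (trans (sym n-odd) n-even))

Even⇒¬Odd : ∀ n → Even n → ¬ Odd n
Even⇒¬Odd _ n-even n-odd = 0≢1+n (trans (sym n-odd) n-even)

record Least (P : Pred ℕ 0ℓ) : Set where
  field
    value    : ℕ
    holds    : P value
    minimal  : ∀ {j} → j < value → ¬ P j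
open Least

least-below-or-none : ∀ {P} → Decidable P → ∀ n → Least P ⊎ (∀ {j} → j < n → ¬ P j)
least-below-or-none P? zero = inj₂ λ ()
least-below-or-none {P} P? (suc n) with least-below-or-none P? n | P? n
... | inj₁ found  | _      = inj₁ found
... | inj₂ none<n | yes pn = inj₁ record { value = n ; holds = pn ; minimal = none<n }
... | inj₂ none<n | no ¬pn = inj₂ λ j<1+n → none≤n (m<1+n⇒m<n∨m≡n j<1+n)
  where
  none≤n : ∀ {j} → j < n ⊎ j ≡ n → ¬ P j
  none≤n (inj₁ j<n)  = none<n j<n
  none≤n (inj₂ refl) = ¬pn

least : ∀ {P} → Decidable P → ∃ P → Least P
least P? (k , pk) with least-below-or-none P? (suc k)
... | inj₁ found = found
... | inj₂ none  = ⊥-elim (none ≤-refl pk)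

least-unique : ∀ {P Q} → (∀ j → P j → Q j) → (∀ j → Q j → P j) →
               (L : Least P) (M : Least Q) → value L ≡ value M
least-unique P⇒Q Q⇒P L M with <-cmp (value L) (value M)
... | tri< l<m _ _ = ⊥-elim (minimal M l<m (P⇒Q _ (holds L)))
... | tri≈ _ l≡m _ = l≡m
... | tri> _ _ m<l = ⊥-elim (minimal L m<l (Q⇒P _ (holds M)))

RootOf : ∀ {n} → (Vec ℕ (suc n) → ℕ) → Vec ℕ n → Pred ℕ 0ℓ
RootOf F xs k = F (k ∷ xs) ≡ 0

leastRoot : ∀ {n} (F : Vec ℕ (suc n) → ℕ) xs → ∃ (RootOf F xs) → Least (RootOf F xs)
leastRoot F xs = least (λ k → F (k ∷ xs) ≟ 0)

mu-computes-leastRoot : ∀ {n F} (t : TotalCode (suc n) F) {xs} (L : Least (RootOf F xs)) →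
                        mu (code t) ⟨ xs ⟩⇓ value L
mu-computes-leastRoot {F = F} t {xs} L =
  ev-mu (subst (code t ⟨ _ ⟩⇓_) (holds L) (computes t _)) positive
  where
  positive : ∀ j → j < value L → Σ ℕ λ w → code t ⟨ j ∷ xs ⟩⇓ suc w
  positive j j<v with F (j ∷ xs) | computes t (j ∷ xs) | minimal L j<v
  ... | zero  | _  | nonroot = ⊥-elim (nonroot refl)
  ... | suc w | ⇓w | _       = w , ⇓w

minimiseᵗ : ∀ {n F} → TotalCode (suc n) F → (root : ∀ xs → ∃ (RootOf F xs)) →
            TotalCode n (λ xs → value (leastRoot F xs (root xs)))
minimiseᵗ {F = F} t root = record
  { code = mu (code t) ; computes = λ xs → mu-computes-leastRoot t (leastRoot F xs (root xs)) }

mu-halts⇒root : ∀ {n F} (t : TotalCode (suc n) F) {xs} → mu (code t) ⟨ xs ⟩↓ → ∃ (RootOf F xs)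
mu-halts⇒root t (k , ev-mu root _) = k , ⇓-deterministic (computes t _) root

rootSet-isCE : ∀ {F A} → TotalCode 2 F → (∀ x → A x ⇔ ∃ (RootOf F (x ∷ []))) → IsCESet A
rootSet-isCE {F} t A⇔root = mu (code t) , λ x →
    (λ ax → _ , mu-computes-leastRoot t (leastRoot F _ (Equivalence.to (A⇔root x) ax)))
  , (λ halts → Equivalence.from (A⇔root x) (mu-halts⇒root t halts))

injection⇒infinite : ∀ {A : ℕ → Set} (h : ℕ → ℕ) → (∀ n → A (h n)) →
                     (∀ {i j} → h i ≡ h j → i ≡ j) → Infinite A
injection⇒infinite {A} h h∈A h-injective (xs , cover) = <-irrefl (h-injective same-value) i<j
  where
  position : Fin (suc (length xs)) → Fin (length xs)
  position i = index (cover (h (toℕ i)) (h∈A (toℕ i)))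

  collision = pigeonhole ≤-refl position
  i = proj₁ collision
  j = proj₁ (proj₂ collision)
  i<j = proj₁ (proj₂ (proj₂ collision))

  same-value : h (toℕ i) ≡ h (toℕ j)
  same-value = begin
    h (toℕ i)                      ≡⟨ lookup-index (cover _ (h∈A (toℕ i))) ⟩
    List.lookup xs (position i)    ≡⟨ cong (List.lookup xs) (proj₂ (proj₂ (proj₂ collision))) ⟩
    List.lookup xs (position j)    ≡⟨ sym (lookup-index (cover _ (h∈A (toℕ j)))) ⟩
    h (toℕ j)                      ∎
    where open ≡-Reasoning

module JoinProperties {R S : ℕ → ℕ → Set} (R-equiv : IsEquivalence R) (S-equiv : IsEquivalence S)
       where

  Join-sym : Symmetric (Join R S)
  Join-sym (inl r) = inl (IsEquivalence.sym R-equiv r)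
  Join-sym (inr s) = inr (IsEquivalence.sym S-equiv s)

  Join-refl : ∀ u → Join R S u u
  Join-refl u with parity-view u
  ... | inj₁ (_ , u≡2h)   =
    subst (λ v → Join R S v v) (sym u≡2h) (inl {x = half u} (IsEquivalence.refl R-equiv))
  ... | inj₂ (_ , u≡2h+1) =
    subst (λ v → Join R S v v) (sym u≡2h+1) (inr {x = half u} (IsEquivalence.refl S-equiv))

  Join-evenness : ∀ {u v} → Join R S u v → evenness u ≡ evenness v
  Join-evenness (inl {x} {y} _) = trans (evenness-double x) (sym (evenness-double y))
  Join-evenness (inr {x} {y} _) = trans (evenness-odd x) (sym (evenness-odd y))

  Join-odd⁻¹ : ∀ {x y} → Join R S (suc (2 * x)) (suc (2 * y)) → S x y
  Join-odd⁻¹ j = odd-part j refl refl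
    where
    double-injective : ∀ {a b} → suc (2 * a) ≡ suc (2 * b) → a ≡ b
    double-injective {a} {b} eq = *-cancelˡ-≡ a b 2 (suc-injective eq)

    odd-part : ∀ {u v x y} → Join R S u v → u ≡ suc (2 * x) → v ≡ suc (2 * y) → S x y
    odd-part (inr s) u≡ v≡ = subst₂ S (double-injective u≡) (double-injective v≡) s
    odd-part {x = x} (inl {x′} _) u≡ _ =
      ⊥-elim (Even⇒¬Odd (2 * x′) (evenness-double x′) (trans (cong evenness u≡) (evenness-odd x)))

module Orbit {E : ℕ → ℕ → Set} (E-sym : Symmetric E) (f : ℕ → ℕ)
             (f-reduces : ∀ x y → (E x y → E (f x) (f y)) × (E (f x) (f y) → E x y)) where

  orbit-preserves : ∀ n {x y} → E x y → E (fold x f n) (fold y f n)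
  orbit-preserves zero    e = e
  orbit-preserves (suc n) e = proj₁ (f-reduces _ _) (orbit-preserves n e)

  orbit-reflects : ∀ n {x y} → E (fold x f n) (fold y f n) → E x y
  orbit-reflects zero    e = e
  orbit-reflects (suc n) e = orbit-reflects n (proj₂ (f-reduces _ _) e)

  cancel-common-steps : ∀ i {k x y} → E (fold x f i) (fold y f (suc (i + k))) →
                        E x (fold y f (suc k))
  cancel-common-steps i {k} {x} {y} e = orbit-reflects i (subst (E (fold x f i)) split e)
    where
    split : fold y f (suc (i + k)) ≡ fold (fold y f (suc k)) f i
    split = trans (cong (fold y f) (sym (+-suc i k))) (fold-+ y f i)

  NonReturning : ℕ → Set
  NonReturning a = ∀ k → ¬ E a (fold a f (suc k))

  orbit-inequivalent : ∀ {a i j} → NonReturning a → i ≢ j → ¬ E (fold a f i) (fold a f j)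
  orbit-inequivalent {i = i} {j} non-returning i≢j e with compare i j
  ... | less    i k = non-returning k (cancel-common-steps i e)
  ... | equal   i   = i≢j refl
  ... | greater j k = non-returning k (cancel-common-steps j (E-sym e))

module SelfReductionOfJoin (em : ExcludedMiddle 0ℓ) (X Y : Ceer) (X-dark : Dark X) (f : ℕ → ℕ)
       (f-reduction : IsReduction (Join (Ceer.rel X) (Ceer.rel Y)) (Join (Ceer.rel X) (Ceer.rel Y)) f)
       where

  private
    R S J : ℕ → ℕ → Set
    R = Ceer.rel X
    S = Ceer.rel Y
    J = Join R S

  open JoinProperties (Ceer.isEq X) (Ceer.isEq Y)
  open Orbit Join-sym f (proj₂ f-reduction)

  iterate-fᵗ : TotalCode₂ (λ k z → fold z f k)
  iterate-fᵗ = iterateᵗ (computable⇒totalCode (proj₁ f-reduction))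

  EvenOrbit : ℕ → Set
  EvenOrbit a = ∀ n → Even (fold a f (suc n))

  OrbitHalves : ℕ → ℕ → Set
  OrbitHalves a x = ∃ λ n → fold a f (suc n) ≡ 2 * x

  orbitHalves-isCE : ∀ a → IsCESet (OrbitHalves a)
  orbitHalves-isCE a = rootSet-isCE distanceᵗ λ x →
    mk⇔ (λ (n , eq) → n , m≡n⇒∣m-n∣≡0 eq) (λ (n , d) → n , ∣m-n∣≡0⇒m≡n d)
    where
    distanceᵗ : TotalCode 2 (λ xs → ∣ fold a f (suc (head xs)) - 2 * head (tail xs) ∣)
    distanceᵗ = comp₂ distᵗ (comp₂ iterate-fᵗ (comp₁ sucᵗ firstᵗ) (constᵗ a)) (comp₁ doubleᵗ secondᵗ)

  orbitHalves-pairwise : ∀ {a} → NonReturning a → PairwiseInequivalent R (OrbitHalves a)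
  orbitHalves-pairwise non-returning x y (i , eqᵢ) (j , eqⱼ) x≢y r with i ≟ j
  ... | yes refl = x≢y (*-cancelˡ-≡ x y 2 (trans (sym eqᵢ) eqⱼ))
  ... | no i≢j   = orbit-inequivalent non-returning (λ eq → i≢j (suc-injective eq))
                                      (subst₂ J (sym eqᵢ) (sym eqⱼ) (inl r))

  orbitHalves-infinite : ∀ {a} → NonReturning a → EvenOrbit a → Infinite (OrbitHalves a)
  orbitHalves-infinite {a} non-returning even =
    injection⇒infinite halfOrbit (λ n → n , Even⇒≡double (even n)) injective
    where
    halfOrbit : ℕ → ℕ
    halfOrbit n = half (fold a f (suc n))

    injective : ∀ {i j} → halfOrbit i ≡ halfOrbit j → i ≡ j
    injective {i} {j} eq with i ≟ j
    ... | yes i≡j = i≡j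
    ... | no i≢j  = ⊥-elim (orbit-inequivalent non-returning (λ eq → i≢j (suc-injective eq))
                                                (subst (J _) same-point (Join-refl _)))
      where
      same-point : fold a f (suc i) ≡ fold a f (suc j)
      same-point = trans (Even⇒≡double (even i))
                         (trans (cong (2 *_) eq) (sym (Even⇒≡double (even j))))

  even-orbit-returns : ∀ {a} → EvenOrbit a → ¬ NonReturning a
  even-orbit-returns even non-returning = proj₂ X-dark
    (OrbitHalves _ , orbitHalves-isCE _ , orbitHalves-infinite non-returning even ,
     orbitHalves-pairwise non-returning)

  odd-in-orbit : ∀ {a} → (EvenOrbit a → NonReturning a) → ∃ λ n → Odd (fold a f (suc n))
  odd-in-orbit {a} even⇒non-returning with em {∃ λ n → Odd (fold a f (suc n))}
  ... | yes found = found
  ... | no none   = ⊥-elim (even-orbit-returns even (even⇒non-returning even))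
    where
    even : EvenOrbit a
    even n = ¬Odd⇒Even (fold a f (suc n)) (λ odd → none (n , odd))

  odd-start⇒non-returning : ∀ {a} → Odd a → EvenOrbit a → NonReturning a
  odd-start⇒non-returning {a} a-odd even k e =
    Even⇒¬Odd (fold a f (suc k)) (even k) (trans (sym (Join-evenness e)) a-odd)

  NoOddBefore : ℕ → ℕ → Set
  NoOddBefore a n = ∀ {j} → j < n → ¬ Odd (fold a f (suc j))

  odd-reappears : ∀ {a c} n {k} → Odd a → J (fold a f (suc n)) (fold c f (suc (suc (n + k)))) →
                  Odd (fold c f (suc k))
  odd-reappears n a-odd e = trans (sym (Join-evenness (cancel-common-steps (suc n) e))) a-odd

  k<1+n+k : ∀ n k → k < suc (n + k)
  k<1+n+k n k = s≤s (m≤n+m k n)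

  first-odd-meeting⇒equivalent : ∀ {a b n m} → Odd a → Odd b →
                                 NoOddBefore a n → NoOddBefore b m →
                                 J (fold a f (suc n)) (fold b f (suc m)) → J a b
  first-odd-meeting⇒equivalent {n = n} {m} a-odd b-odd a-first b-first e with compare n m
  ... | less    n k = ⊥-elim (b-first (k<1+n+k n k) (odd-reappears n a-odd e))
  ... | equal   n   = orbit-reflects (suc n) e
  ... | greater m k = ⊥-elim (a-first (k<1+n+k m k) (odd-reappears m b-odd (Join-sym e)))

  OddOrbitReaches : ℕ → Set
  OddOrbitReaches v = ∃ λ a → ∃ λ n → Odd a × J (fold a f (suc n)) v

  reached⇒hit : ∀ {c} → OddOrbitReaches c → ∃ λ z → J (f z) c
  reached⇒hit (a , n , _ , e) = fold a f n , e

  first-odd-reached⇒hit : ∀ {c m} → Even c → NoOddBefore c m →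
                          OddOrbitReaches (fold c f (suc m)) → ∃ λ z → J (f z) c
  first-odd-reached⇒hit {c} {m} c-even c-first (a , n , a-odd , e) with compare n m
  ... | less    n k = ⊥-elim (c-first (k<1+n+k n k) (odd-reappears n a-odd e))
  ... | equal   n   =
    ⊥-elim (Even⇒¬Odd c c-even (trans (sym (Join-evenness (orbit-reflects (suc n) e))) a-odd))
  ... | greater m k = fold a f k , Join-sym (cancel-common-steps (suc m) (Join-sym e))

  evennessAlongOddOrbit : Vec ℕ 2 → ℕ
  evennessAlongOddOrbit xs = evenness (fold (suc (2 * head (tail xs))) f (suc (head xs)))

  evennessAlongOddOrbitᵗ : TotalCode 2 evennessAlongOddOrbit
  evennessAlongOddOrbitᵗ =
    comp₁ evennessᵗ (comp₂ iterate-fᵗ (comp₁ sucᵗ firstᵗ) (comp₁ sucᵗ (comp₁ doubleᵗ secondᵗ)))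

  odd-reached : ∀ xs → ∃ (RootOf evennessAlongOddOrbit xs)
  odd-reached (y ∷ []) = odd-in-orbit (odd-start⇒non-returning (evenness-odd y))

  firstOdd : ∀ y → Least (λ n → Odd (fold (suc (2 * y)) f (suc n)))
  firstOdd y = leastRoot evennessAlongOddOrbit (y ∷ []) (odd-reached (y ∷ []))

  firstOddTime : ℕ → ℕ
  firstOddTime y = value (firstOdd y)

  g : ℕ → ℕ
  g y = half (fold (suc (2 * y)) f (suc (firstOddTime y)))

  gᵗ : TotalCode₁ g
  gᵗ = TotalCode-cong (λ { (y ∷ []) → refl })
         (comp₁ halfᵗ (comp₂ iterate-fᵗ (comp₁ sucᵗ (minimiseᵗ evennessAlongOddOrbitᵗ odd-reached))
                                        (comp₁ sucᵗ doubleᵗ)))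

  firstOdd-point : ∀ y → fold (suc (2 * y)) f (suc (firstOddTime y)) ≡ suc (2 * g y)
  firstOdd-point y = Odd⇒≡suc-double (holds (firstOdd y))

  firstOddTime-respects : ∀ {y y′} → S y y′ → firstOddTime y ≡ firstOddTime y′
  firstOddTime-respects {y} {y′} s =
    least-unique (transfer s) (transfer (IsEquivalence.sym (Ceer.isEq Y) s)) (firstOdd y) (firstOdd y′)
    where
    transfer : ∀ {y y′} → S y y′ → ∀ j → Odd (fold (suc (2 * y)) f (suc j)) →
               Odd (fold (suc (2 * y′)) f (suc j))
    transfer s j odd = trans (sym (Join-evenness (orbit-preserves (suc j) (inr s)))) odd

  g-preserves : ∀ {y y′} → S y y′ → S (g y) (g y′)
  g-preserves {y} {y′} s = Join-odd⁻¹ (subst₂ J (firstOdd-point y) same-time-point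
                                         (orbit-preserves (suc (firstOddTime y)) (inr s)))
    where
    same-time-point : fold (suc (2 * y′)) f (suc (firstOddTime y)) ≡ suc (2 * g y′)
    same-time-point rewrite firstOddTime-respects s = firstOdd-point y′

  g-reflects : ∀ {y y′} → S (g y) (g y′) → S y y′
  g-reflects {y} {y′} s = Join-odd⁻¹
    (first-odd-meeting⇒equivalent (evenness-odd y) (evenness-odd y′)
                                  (minimal (firstOdd y)) (minimal (firstOdd y′))
                                  (subst₂ J (sym (firstOdd-point y)) (sym (firstOdd-point y′)) (inr s)))

  g-reduction : IsReduction S S g
  g-reduction = totalCode⇒computable gᵗ , λ _ _ → g-preserves , g-reflects

  module _ (S-selfFull : SelfFull S) where

    odd-classes-reached : ∀ {v} → Odd v → OddOrbitReaches v
    odd-classes-reached {v} v-odd with S-selfFull g g-reduction (half v)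
    ... | y , s = suc (2 * y) , firstOddTime y , evenness-odd y ,
                  subst₂ J (sym (firstOdd-point y)) (sym (Odd⇒≡suc-double v-odd)) (inr s)

    even-classes-hit : ∀ {c} → Even c → ∃ λ z → J (f z) c
    even-classes-hit {c} c-even with em {∃ λ z → J (f z) c}
    ... | yes hit = hit
    ... | no miss =
      ⊥-elim (miss (first-odd-reached⇒hit c-even (minimal first) (odd-classes-reached (holds first))))
      where
      non-returning : NonReturning c
      non-returning k e = miss (fold c f k , Join-sym e)

      first : Least (λ n → Odd (fold c f (suc n)))
      first = least (λ n → evenness (fold c f (suc n)) ≟ 0) (odd-in-orbit (λ _ → non-returning))

    every-class-hit : ∀ c → ∃ λ z → J (f z) c
    every-class-hit c with parity-view c
    ... | inj₁ (c-even , _) = even-classes-hit c-even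
    ... | inj₂ (c-odd , _)  = reached⇒hit (odd-classes-reached c-odd)

mainTheorem4 : ExcludedMiddle 0ℓ → (X : Ceer) → Dark X → HereditarilySelfFull X
mainTheorem4 em X X-dark Y Y-selfFull f f-reduction =
  SelfReductionOfJoin.every-class-hit em X Y X-dark f f-reduction Y-selfFull
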